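{- Let $k,m\in\mathbb{N}$, let $G=(V,E,\le)$ be a $(k+m+1)$-connected $d$-regular base graph, $f\colon E\to\mathbb{Z}_{2^q}$, $\mathfrak{A}=\mathsf{CFI}_{2^q}(G,f)$ with universe $A$, and $\bar p\in A^m$. For every $k$-orbit $P$ of $(\mathfrak{A},\bar p)$, the permutation group on $P$ induced by $\mathrm{Aut}(\mathfrak{A},\bar p)$ is a regular abelian $2$-group.
   Context: A base graph is a finite simple connected graph $G=(V,E)$ with a total order $\le$ on $V$. $\mathsf{CFI}_{2^q}(G,f)$ has universe the disjoint union of $A_x=\{\bar a\in\mathbb{Z}_{2^q}^{N_G(x)}:\sum\bar a=0\}$; binary relations $R_{E,c}=\bigcup_{e\in E}E_{e,c+f(e)}$ with $E_{\{x,y\},c}=\{\{\bar a,\bar b\}:\bar a\in A_x,\bar b\in A_y,\bar a(y)+\bar b(x)=c\}$; a preorder ordering the gadgets $A_x$ by $\le$; and 4-ary relations encoding the relations $I_{x,y}=\{(\bar a,\bar b)\in A_x^2:\bar a(y)=\bar b(y)\}$ and $C_{x,y}=\{(\bar a,\bar b)\in A_x^2:\bar a(y)+1=\bar b(y)\}$. $\mathrm{Aut}(\mathfrak{A},\bar p)$ is the group of automorphisms fixing each entry of $\bar p$; a $k$-orbit is an orbit of this group on $A^k$ (acting entrywise). A graph is $n$-connected if it has $\ge n$ vertices and stays connected after deleting any $\le n-1$ vertices. A permutation group on $P$ is regular if it is transitive and has exactly $|P|$ elements. -}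

module Defs where

open import Data.Nat using (ℕ; zero; suc; _+_; _^_; _≤_; _<_; _∸_; NonZero; _≡ᵇ_)
open import Data.Nat.Properties using (m^n≢0; m^n>0)
open import Data.Nat.DivMod using (_%_; m%n<n)
open import Data.Fin as Fin using (Fin; toℕ; fromℕ<)
open import Data.Bool using (Bool; true; false; T; _∧_; _∨_)
open import Data.Bool.ListAction using (and)
open import Data.List as List using (List; []; _∷_; allFin; filterᵇ; length)
open import Data.List.Membership.Propositional using (_∈_; _∉_)
open import Data.Vec as Vec using (Vec; lookup)
open import Data.Product using (Σ; _×_; _,_; ∃; proj₁)
open import Relation.Binary.PropositionalEquality using (_≡_)
open import Relation.Binary.Bundles using (Setoid)
open import Function.Bundles using (Inverse)
import Relation.Binary.PropositionalEquality as PE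

Z : ℕ → Set
Z q = Fin (2 ^ q)

module _ (q : ℕ) where
  private
    instance
      nz : NonZero (2 ^ q)
      nz = m^n≢0 2 q

  ofℕ : ℕ → Z q
  ofℕ a = fromℕ< (m%n<n a (2 ^ q))

  zeroZ : Z q
  zeroZ = ofℕ 0

  oneZ : Z q
  oneZ = ofℕ 1

  _+Z_ : Z q → Z q → Z q
  a +Z b = ofℕ (toℕ a + toℕ b)

  sumZ : ∀ {l} → Vec (Z q) l → Z q
  sumZ = Vec.foldr _ _+Z_ zeroZ

  isZeroZ : Z q → Bool
  isZeroZ a = toℕ a ≡ᵇ 0

-- Vertices are Fin n; the total order is the natural order on Fin n
-- (every finite total order is of this form up to relabelling).

data Walk {n : ℕ} (adj : Fin n → Fin n → Bool) (S : List (Fin n))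
          : Fin n → Fin n → Set where
  stop : ∀ {u} → Walk adj S u u
  step : ∀ {u w v} → adj u w ≡ true → w ∉ S → Walk adj S w v → Walk adj S u v

ConnectedAvoiding : {n : ℕ} → (Fin n → Fin n → Bool) → List (Fin n) → Set
ConnectedAvoiding adj S = ∀ u v → u ∉ S → v ∉ S → Walk adj S u v

record BaseGraph : Set where
  field
    n       : ℕ
    adj     : Fin n → Fin n → Bool
    adj-sym : ∀ x y → adj x y ≡ adj y x
    irrefl  : ∀ x → adj x x ≡ false
    connected : ConnectedAvoiding adj []

module _ (G : BaseGraph) where
  open BaseGraph G

  IsConnectedN : ℕ → Set
  IsConnectedN c = c ≤ n × (∀ (S : List (Fin n)) → length S ≤ c ∸ 1 → ConnectedAvoiding adj S)

  degree : Fin n → ℕ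
  degree x = length (filterᵇ (adj x) (allFin n))

  IsRegular : ℕ → Set
  IsRegular d = ∀ x → degree x ≡ d

-- The CFI structure CFI_{2^q}(G, f).
-- f : E → ℤ_{2^q} is given as a function on ordered pairs of vertices
-- (only its values on edges matter; symmetry is a hypothesis of the theorem).

module CFI (q : ℕ) (G : BaseGraph) (f : Fin (BaseGraph.n G) → Fin (BaseGraph.n G) → Z q) where
  open BaseGraph G

  -- ā ∈ ℤ_{2^q}^{N(x)} is encoded by a vector indexed by all of V that is
  -- zero outside N(x); gadget condition: sum ā = 0.
  gadgetOK : Fin n → Vec (Z q) n → Bool
  gadgetOK x a = and (List.map (λ y → adj x y ∨ isZeroZ q (lookup a y)) (allFin n))
                 ∧ isZeroZ q (sumZ q a)

  record Elem : Set where
    constructor elem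
    field
      vtx  : Fin n
      vec  : Vec (Z q) n
      ok   : T (gadgetOK vtx vec)
  open Elem public

  _at_ : Elem → Fin n → Z q
  a at y = lookup (vec a) y

  -- R_{E,c} = ⋃_{e ∈ E} E_{e, c + f(e)}
  REdge : Z q → Elem → Elem → Set
  REdge c a b = adj (vtx a) (vtx b) ≡ true
              × (_+Z_ q (a at vtx b) (b at vtx a) ≡ _+Z_ q c (f (vtx a) (vtx b)))

  RPre : Elem → Elem → Set
  RPre a b = vtx a Fin.≤ vtx b

  -- 4-ary encoding of I_{x,y}: (ā, b̄, c̄, d̄) with ā, b̄ ∈ A_x, c̄, d̄ ∈ A_y,
  -- xy ∈ E, and (ā, b̄) ∈ I_{x,y}
  RI : Elem → Elem → Elem → Elem → Set
  RI a b c d = vtx a ≡ vtx b × vtx c ≡ vtx d × adj (vtx a) (vtx c) ≡ true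
             × a at vtx c ≡ b at vtx c

  -- 4-ary encoding of C_{x,y}: as above with (ā, b̄) ∈ C_{x,y}
  RC : Elem → Elem → Elem → Elem → Set
  RC a b c d = vtx a ≡ vtx b × vtx c ≡ vtx d × adj (vtx a) (vtx c) ≡ true
             × _+Z_ q (a at vtx c) (oneZ q) ≡ b at vtx c

  _⇔_ : Set → Set → Set
  P ⇔ Q = (P → Q) × (Q → P)

  record Aut {m : ℕ} (p : Vec Elem m) : Set where
    field
      fun      : Elem → Elem
      inv      : Elem → Elem
      inv-l    : ∀ a → inv (fun a) ≡ a
      inv-r    : ∀ a → fun (inv a) ≡ a
      pres-E   : ∀ c a b → REdge c a b ⇔ REdge c (fun a) (fun b)
      pres-Pre : ∀ a b → RPre a b ⇔ RPre (fun a) (fun b)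
      pres-I   : ∀ a b c d → RI a b c d ⇔ RI (fun a) (fun b) (fun c) (fun d)
      pres-C   : ∀ a b c d → RC a b c d ⇔ RC (fun a) (fun b) (fun c) (fun d)
      fixes    : ∀ i → fun (lookup p i) ≡ lookup p i
  open Aut public

  act : ∀ {m k} {p : Vec Elem m} → Aut p → Vec Elem k → Vec Elem k
  act σ = Vec.map (fun σ)

  InOrbit : ∀ {m k} (p : Vec Elem m) → Vec Elem k → Vec Elem k → Set
  InOrbit p u v = ∃ λ (σ : Aut p) → act σ u ≡ v

  OrbitSetoid : ∀ {m k} (p : Vec Elem m) → Vec Elem k → Setoid _ _
  OrbitSetoid {k = k} p u = record
    { Carrier = Σ (Vec Elem k) (InOrbit p u)
    ; _≈_ = λ v w → proj₁ v ≡ proj₁ w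
    ; isEquivalence = record
      { refl = Relation.Binary.PropositionalEquality.refl
      ; sym = Relation.Binary.PropositionalEquality.sym
      ; trans = Relation.Binary.PropositionalEquality.trans } }

  -- the permutation group on P induced by Aut(𝔄, p̄): automorphisms are
  -- identified when they induce the same permutation of P
  InducedGroup : ∀ {m k} (p : Vec Elem m) → Vec Elem k → Setoid _ _
  InducedGroup {k = k} p u = record
    { Carrier = Aut p
    ; _≈_ = λ σ τ → ∀ v → InOrbit p u v → act σ v ≡ act τ v
    ; isEquivalence = record
      { refl = λ v _ → Relation.Binary.PropositionalEquality.refl
      ; sym = λ e v h → Relation.Binary.PropositionalEquality.sym (e v h)
      ; trans = λ e₁ e₂ v h → Relation.Binary.PropositionalEquality.trans (e₁ v h) (e₂ v h) } }

  InducedTransitive : ∀ {m k} (p : Vec Elem m) → Vec Elem k → Set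
  InducedTransitive p u =
    ∀ v w → InOrbit p u v → InOrbit p u w → ∃ λ (σ : Aut p) → act σ v ≡ w

  -- the induced group has exactly |P| elements
  InducedHasOrbitSize : ∀ {m k} (p : Vec Elem m) → Vec Elem k → Set
  InducedHasOrbitSize p u = Inverse (InducedGroup p u) (OrbitSetoid p u)

  InducedRegular : ∀ {m k} (p : Vec Elem m) → Vec Elem k → Set
  InducedRegular p u = InducedTransitive p u × InducedHasOrbitSize p u

  InducedAbelian : ∀ {m k} (p : Vec Elem m) → Vec Elem k → Set
  InducedAbelian p u =
    ∀ (σ τ : Aut p) v → InOrbit p u v → act σ (act τ v) ≡ act τ (act σ v)

  Induced2Group : ∀ {m k} (p : Vec Elem m) → Vec Elem k → Set
  Induced2Group p u = ∃ λ j → Inverse (InducedGroup p u) (PE.setoid (Fin (2 ^ j)))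

-- Every automorphism of 𝔄 = CFI_{2^q}(G, f) preserves the preorder of the gadgets, so (as an
-- order-preserving permutation of the finite chain V) it fixes every gadget A_x; since it also
-- preserves I_{x,y} and C_{x,y}, it adds a constant t_x(y) to the y-coordinate of every ā ∈ A_x.
-- Automorphisms are therefore translations, and translations commute: Aut(𝔄, p̄) is abelian, so the
-- permutation group it induces on an orbit P of ū is abelian and transitive, hence regular (whatever
-- fixes ū fixes every σ ū). Recording the shifts t_x at the gadgets of ū identifies the induced
-- group with a decidable subgroup of ℤ_{2^q}^{k·|V|}, and such a subgroup has 2^j elements: peeling
-- off one binary digit of one coordinate at a time, each step passes to the kernel of a
-- homomorphism to ℤ₂, of index 1 or 2.

module Submission where

open import Defs
open import Algebra.Bundles using (AbelianGroup)
open import Algebra.Core using (Op₁; Op₂)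
open import Algebra.Structures using (IsAbelianGroup)
import Algebra.Properties.AbelianGroup as AbelianGroupProperties
import Algebra.Properties.CommutativeSemigroup as CommutativeSemigroupProperties
open import Data.Bool using (Bool; true; false; T; _∨_)
open import Data.Bool.Properties using (T-∧; T-∨; T-irrelevant)
import Data.Bool.Properties as Bool
open import Data.Empty using (⊥; ⊥-elim)
open import Data.List using (allFin)
open import Data.List.Membership.Propositional.Properties using (∈-allFin)
import Data.List.Relation.Unary.All as All
open import Data.List.Relation.Unary.All.Properties using (all⁺; all⁻)
open import Data.Nat using (ℕ; zero; suc; _+_; _*_; _^_; _∸_; _≤_; z≤n; s≤s; NonZero)
open import Data.Nat.Properties
  using (+-assoc; +-comm; *-comm; +-suc; +-identityʳ; m^n≢0; m*n≢0; m∸n+n≡m; <⇒≤; ^-distribˡ-+-*;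
         ≡ᵇ⇒≡; ≡⇒≡ᵇ)
import Data.Nat.Properties as ℕ
open import Data.Nat.DivMod
  using (_%_; _/_; m<n⇒m%n≡m; n%n≡0; m*n%n≡0; %-distribˡ-+; %-congʳ; m%[n*o]/o≡m/o%n;
         m∣n⇒o%n%m≡o%m; +-distrib-/-∣ˡ)
open import Data.Nat.Divisibility using (_∣_; divides; 1∣_; n∣m⇒m%n≡0; m%n≡0⇒n∣m; m∣n/o⇒m*o∣n)
open import Data.Fin as Fin using (Fin; toℕ; inject₁; combine; remQuot)
open import Data.Fin.Properties
  using (toℕ-injective; toℕ-fromℕ<; toℕ<n; toℕ-inject₁; remQuot-combine; combine-remQuot)
import Data.Fin.Properties as Fin
open import Data.Fin.Induction using (<-weakInduction)
open import Data.Vec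
  using (Vec; []; _∷_; _++_; zipWith; map; replicate; lookup; tabulate; head; tail; _[_]≔_)
open import Data.Vec.Properties
  using (zipWith-assoc; zipWith-comm; zipWith-identityˡ; zipWith-identityʳ; zipWith-inverseˡ;
         zipWith-inverseʳ; lookup-zipWith; lookup-map; lookup-replicate; lookup∘update; lookup∘update′;
         lookup∘tabulate;
         map-∘; map-cong; map-id; map-++; zipWith-++; ++-injective; ∷-injectiveˡ; ∷-injectiveʳ; ≡-dec)
open import Data.Vec.Relation.Binary.Pointwise.Extensional using (ext; Pointwise-≡⇒≡)
open import Data.Product using (∃; _×_; _,_; proj₁; proj₂; uncurry)
open import Data.Sum using (_⊎_; inj₁; inj₂)
open import Data.Unit using (tt)
open import Function using (_∘_; id)
open import Function.Bundles using (Equivalence)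
open import Level using (0ℓ)
open import Relation.Nullary using (Dec; yes; no; ¬?)
open import Relation.Nullary.Decidable using (map′; _×-dec_; _→-dec_; T?)
open import Relation.Unary using (Decidable)
open import Relation.Binary.PropositionalEquality
  using (_≡_; _≢_; refl; sym; trans; cong; cong₂; subst; subst₂; isEquivalence; module ≡-Reasoning)

strictMono⇒inflationary : ∀ {k} (h : Fin k → Fin k) → (∀ {x y} → x Fin.< y → h x Fin.< h y) →
                          ∀ x → x Fin.≤ h x
strictMono⇒inflationary {suc k} h h-mono = <-weakInduction (λ x → x Fin.≤ h x) z≤n suc-case
  where
    suc-case : ∀ i → inject₁ i Fin.≤ h (inject₁ i) → Fin.suc i Fin.≤ h (Fin.suc i)
    suc-case i i≤hi = ℕ.≤-trans (s≤s (subst (_≤ toℕ (h (inject₁ i))) (toℕ-inject₁ i) i≤hi))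
                            (h-mono (s≤s (ℕ.≤-reflexive (toℕ-inject₁ i))))

∃-Vec? : ∀ {A : Set} → (∀ {P : A → Set} → Decidable P → Dec (∃ P)) →
         ∀ k {P : Vec A k → Set} → Decidable P → Dec (∃ P)
∃-Vec? ∃A? zero P? = map′ ([] ,_) (λ { ([] , P[]) → P[] }) (P? [])
∃-Vec? ∃A? (suc k) P? = map′ (λ (x , xs , Pxxs) → x ∷ xs , Pxxs)
                             (λ { (x ∷ xs , Pxxs) → x , xs , Pxxs })
                             (∃A? (λ x → ∃-Vec? ∃A? k (P? ∘ (x ∷_))))

replicate-++ : ∀ {A : Set} k l (x : A) → replicate k x ++ replicate l x ≡ replicate (k + l) x
replicate-++ zero l x = refl
replicate-++ (suc k) l x = cong (x ∷_) (replicate-++ k l x)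

lookup-ext : ∀ {A : Set} {n} {xs ys : Vec A n} → (∀ i → lookup xs i ≡ lookup ys i) → xs ≡ ys
lookup-ext h = Pointwise-≡⇒≡ (ext h)

module _ {A : Set} {_∙_ : Op₂ A} {ε : A} {_⁻¹ : Op₁ A} where

  ≡-abelianGroup : IsAbelianGroup _≡_ _∙_ ε _⁻¹ → AbelianGroup 0ℓ 0ℓ
  ≡-abelianGroup G = record { isAbelianGroup = G }

  zipWith-isAbelianGroup : IsAbelianGroup _≡_ _∙_ ε _⁻¹ → ∀ n →
    IsAbelianGroup _≡_ (zipWith {n = n} _∙_) (replicate n ε) (map _⁻¹)
  zipWith-isAbelianGroup G n = record
    { isGroup = record
      { isMonoid = record
        { isSemigroup = record
          { isMagma = record { isEquivalence = isEquivalence ; ∙-cong = cong₂ (zipWith _∙_) }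
          ; assoc = zipWith-assoc assoc }
        ; identity = zipWith-identityˡ identityˡ , zipWith-identityʳ identityʳ }
      ; inverse = zipWith-inverseˡ inverseˡ , zipWith-inverseʳ inverseʳ
      ; ⁻¹-cong = cong (map _⁻¹) }
    ; comm = zipWith-comm comm }
    where open IsAbelianGroup G using (assoc; identityˡ; identityʳ; inverseˡ; inverseʳ; comm)

module ZProperties (q : ℕ) where

  private
    M : ℕ
    M = 2 ^ q

    instance
      M≢0 : NonZero M
      M≢0 = m^n≢0 2 q

    [_] : ℕ → Z q
    [_] = ofℕ q

    _⊕_ : Op₂ (Z q)
    _⊕_ = _+Z_ q

  negZ : Op₁ (Z q)
  negZ x = [ M ∸ toℕ x ]

  toℕ-ofℕ : ∀ a → toℕ [ a ] ≡ a % M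
  toℕ-ofℕ a = toℕ-fromℕ< _

  toℕ-zeroZ : toℕ (zeroZ q) ≡ 0
  toℕ-zeroZ = trans (toℕ-ofℕ 0) (m*n%n≡0 0 M)

  ofℕ-cong-% : ∀ {a b} → a % M ≡ b % M → [ a ] ≡ [ b ]
  ofℕ-cong-% e = toℕ-injective (trans (toℕ-ofℕ _) (trans e (sym (toℕ-ofℕ _))))

  ofℕ-toℕ : ∀ x → [ toℕ x ] ≡ x
  ofℕ-toℕ x = toℕ-injective (trans (toℕ-ofℕ _) (m<n⇒m%n≡m (toℕ<n x)))

  ofℕ-+ : ∀ a b → [ a ] ⊕ [ b ] ≡ [ a + b ]
  ofℕ-+ a b = ofℕ-cong-% (begin
    (toℕ [ a ] + toℕ [ b ]) % M ≡⟨ cong₂ (λ u v → (u + v) % M) (toℕ-ofℕ a) (toℕ-ofℕ b) ⟩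
    (a % M + b % M) % M         ≡⟨ %-distribˡ-+ a b M ⟨
    (a + b) % M                 ∎)
    where open ≡-Reasoning

  -- Every law is transported from ℕ along the surjective homomorphism [_].
  +Z-assoc : ∀ x y z → (x ⊕ y) ⊕ z ≡ x ⊕ (y ⊕ z)
  +Z-assoc x y z = begin
    [ toℕ x + toℕ y ] ⊕ z             ≡⟨ cong ([ toℕ x + toℕ y ] ⊕_) (ofℕ-toℕ z) ⟨
    [ toℕ x + toℕ y ] ⊕ [ toℕ z ]     ≡⟨ ofℕ-+ (toℕ x + toℕ y) (toℕ z) ⟩
    [ toℕ x + toℕ y + toℕ z ]         ≡⟨ cong [_] (+-assoc (toℕ x) (toℕ y) (toℕ z)) ⟩
    [ toℕ x + (toℕ y + toℕ z) ]       ≡⟨ ofℕ-+ (toℕ x) (toℕ y + toℕ z) ⟨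
    [ toℕ x ] ⊕ [ toℕ y + toℕ z ]     ≡⟨ cong (_⊕ [ toℕ y + toℕ z ]) (ofℕ-toℕ x) ⟩
    x ⊕ [ toℕ y + toℕ z ]             ∎
    where open ≡-Reasoning

  +Z-comm : ∀ x y → x ⊕ y ≡ y ⊕ x
  +Z-comm x y = cong [_] (+-comm (toℕ x) (toℕ y))

  +Z-identityˡ : ∀ x → zeroZ q ⊕ x ≡ x
  +Z-identityˡ x = begin
    [ 0 ] ⊕ x             ≡⟨ cong ([ 0 ] ⊕_) (ofℕ-toℕ x) ⟨
    [ 0 ] ⊕ [ toℕ x ]     ≡⟨ ofℕ-+ 0 (toℕ x) ⟩
    [ toℕ x ]             ≡⟨ ofℕ-toℕ x ⟩
    x                     ∎
    where open ≡-Reasoning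

  +Z-inverseˡ : ∀ x → negZ x ⊕ x ≡ zeroZ q
  +Z-inverseˡ x = begin
    [ M ∸ toℕ x ] ⊕ x             ≡⟨ cong ([ M ∸ toℕ x ] ⊕_) (ofℕ-toℕ x) ⟨
    [ M ∸ toℕ x ] ⊕ [ toℕ x ]     ≡⟨ ofℕ-+ (M ∸ toℕ x) (toℕ x) ⟩
    [ M ∸ toℕ x + toℕ x ]         ≡⟨ cong [_] (m∸n+n≡m (<⇒≤ (toℕ<n x))) ⟩
    [ M ]                         ≡⟨ ofℕ-cong-% (trans (n%n≡0 M) (sym (m*n%n≡0 0 M))) ⟩
    [ 0 ]                         ∎
    where open ≡-Reasoning

  +Z-isAbelianGroup : IsAbelianGroup _≡_ _⊕_ (zeroZ q) negZ
  +Z-isAbelianGroup = record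
    { isGroup = record
      { isMonoid = record
        { isSemigroup = record
          { isMagma = record { isEquivalence = isEquivalence ; ∙-cong = cong₂ _⊕_ }
          ; assoc = +Z-assoc }
        ; identity = +Z-identityˡ , λ x → trans (+Z-comm x _) (+Z-identityˡ x) }
      ; inverse = +Z-inverseˡ , λ x → trans (+Z-comm x _) (+Z-inverseˡ x)
      ; ⁻¹-cong = cong negZ }
    ; comm = +Z-comm }

module Subgroups {C : Set} (_∙_ : Op₂ C) (ε : C) (_⁻¹ : Op₁ C) where

  record IsDecSubgroup (S : C → Set) : Set₁ where
    field
      ε∈        : S ε
      ∙-closed  : ∀ {a b} → S a → S b → S (a ∙ b)
      ⁻¹-closed : ∀ {a} → S a → S (a ⁻¹)
      ∃?        : (Q : C → Set) → Decidable Q → Dec (∃ λ a → S a × Q a)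

  record HasSize2^ (S : C → Set) : Set where
    field
      j       : ℕ
      enc     : Fin (2 ^ j) → C
      enc∈    : ∀ i → S (enc i)
      dec     : C → Fin (2 ^ j)
      dec∘enc : ∀ i → dec (enc i) ≡ i
      enc∘dec : ∀ {s} → S s → enc (dec s) ≡ s

module ℤ₂ where
  open ZProperties 1 using (+Z-identityˡ) public

  _+₂_ : Op₂ (Z 1)
  _+₂_ = _+Z_ 1

  0₂ 1₂ : Z 1
  0₂ = zeroZ 1
  1₂ = oneZ 1

  0₂-or-1₂ : ∀ x → x ≡ 0₂ ⊎ x ≡ 1₂
  0₂-or-1₂ Fin.zero = inj₁ refl
  0₂-or-1₂ (Fin.suc Fin.zero) = inj₂ refl

  x+x≡0 : ∀ x → x +₂ x ≡ 0₂
  x+x≡0 Fin.zero = refl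
  x+x≡0 (Fin.suc Fin.zero) = refl

  x+y≡0⇒y≡x : ∀ x y → x +₂ y ≡ 0₂ → y ≡ x
  x+y≡0⇒y≡x Fin.zero Fin.zero _ = refl
  x+y≡0⇒y≡x (Fin.suc Fin.zero) (Fin.suc Fin.zero) _ = refl
  x+y≡0⇒y≡x Fin.zero (Fin.suc Fin.zero) ()
  x+y≡0⇒y≡x (Fin.suc Fin.zero) Fin.zero ()

-- A subgroup S with a homomorphism χ : S → ℤ₂ is its kernel plus at most one more coset,
-- so it has the size of the kernel or twice that.
module IndexTwo {C : Set} {_∙_ : Op₂ C} {ε : C} {_⁻¹ : Op₁ C}
                (isAbelianGroup : IsAbelianGroup _≡_ _∙_ ε _⁻¹) where

  open Subgroups _∙_ ε _⁻¹
  open IsAbelianGroup isAbelianGroup using (identityˡ; inverseʳ)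
  open AbelianGroupProperties (≡-abelianGroup isAbelianGroup)
    using (//-rightDividesˡ; //-rightDividesʳ)
  open ℤ₂

  module _ {S : C → Set} (S-sub : IsDecSubgroup S) (χ : C → Z 1)
           (χ-∙ : ∀ {a b} → S a → S b → χ (a ∙ b) ≡ χ a +₂ χ b) where

    open IsDecSubgroup S-sub

    Kernel : C → Set
    Kernel s = S s × χ s ≡ 0₂

    χ-ε : χ ε ≡ 0₂
    χ-ε = begin
      χ ε         ≡⟨ cong χ (identityˡ ε) ⟨
      χ (ε ∙ ε)   ≡⟨ χ-∙ ε∈ ε∈ ⟩
      χ ε +₂ χ ε  ≡⟨ x+x≡0 (χ ε) ⟩
      0₂          ∎
      where open ≡-Reasoning

    χ-⁻¹ : ∀ {a} → S a → χ (a ⁻¹) ≡ χ a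
    χ-⁻¹ {a} a∈ = x+y≡0⇒y≡x (χ a) (χ (a ⁻¹))
      (trans (sym (χ-∙ a∈ (⁻¹-closed a∈))) (trans (cong χ (inverseʳ a)) χ-ε))

    kernel-isDecSubgroup : IsDecSubgroup Kernel
    kernel-isDecSubgroup = record
      { ε∈        = ε∈ , χ-ε
      ; ∙-closed  = λ (a∈ , χa) (b∈ , χb) →
          ∙-closed a∈ b∈ , trans (χ-∙ a∈ b∈) (cong₂ _+₂_ χa χb)
      ; ⁻¹-closed = λ (a∈ , χa) → ⁻¹-closed a∈ , trans (χ-⁻¹ a∈) χa
      ; ∃?        = λ Q Q? → map′ (λ (s , s∈ , χs , Qs) → s , (s∈ , χs) , Qs)
                                  (λ (s , (s∈ , χs) , Qs) → s , s∈ , χs , Qs)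
                                  (∃? _ (λ s → (χ s Fin.≟ 0₂) ×-dec Q? s))
      }

    -- Given w ∈ S with χ w = 1, the map s ↦ (χ s , s ∙ (w^ χ s)⁻¹) is a bijection S ≅ ℤ₂ × Kernel.
    module Doubling (K : HasSize2^ Kernel) (w : C) (w∈ : S w) (χw : χ w ≡ 1₂) where
      open HasSize2^ K

      w^ : Z 1 → C
      w^ Fin.zero = ε
      w^ (Fin.suc Fin.zero) = w

      w^∈ : ∀ c → S (w^ c)
      w^∈ Fin.zero = ε∈
      w^∈ (Fin.suc Fin.zero) = w∈

      χ-w^ : ∀ c → χ (w^ c) ≡ c
      χ-w^ Fin.zero = χ-ε
      χ-w^ (Fin.suc Fin.zero) = χw

      unshift : C → C
      unshift s = s ∙ (w^ (χ s) ⁻¹)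

      unshift∈ : ∀ {s} → S s → Kernel (unshift s)
      unshift∈ {s} s∈ = ∙-closed s∈ (⁻¹-closed (w^∈ (χ s))) , (begin
        χ (s ∙ (w^ (χ s) ⁻¹))        ≡⟨ χ-∙ s∈ (⁻¹-closed (w^∈ (χ s))) ⟩
        χ s +₂ χ (w^ (χ s) ⁻¹)       ≡⟨ cong (χ s +₂_) (trans (χ-⁻¹ (w^∈ _)) (χ-w^ (χ s))) ⟩
        χ s +₂ χ s                   ≡⟨ x+x≡0 (χ s) ⟩
        0₂                           ∎)
        where open ≡-Reasoning

      encPair : Z 1 × Fin (2 ^ j) → C
      encPair (c , i) = enc i ∙ w^ c

      decPair : C → Z 1 × Fin (2 ^ j)
      decPair s = χ s , dec (unshift s)

      χ-encPair : ∀ c i → χ (encPair (c , i)) ≡ c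
      χ-encPair c i = begin
        χ (enc i ∙ w^ c)       ≡⟨ χ-∙ (proj₁ (enc∈ i)) (w^∈ c) ⟩
        χ (enc i) +₂ χ (w^ c)  ≡⟨ cong₂ _+₂_ (proj₂ (enc∈ i)) (χ-w^ c) ⟩
        0₂ +₂ c                ≡⟨ +Z-identityˡ c ⟩
        c                      ∎
        where open ≡-Reasoning

      decPair∘encPair : ∀ c i → decPair (encPair (c , i)) ≡ (c , i)
      decPair∘encPair c i with χ (encPair (c , i)) | χ-encPair c i
      ... | _ | refl = cong (c ,_) (trans (cong dec (//-rightDividesʳ (w^ c) (enc i))) (dec∘enc i))

      size : HasSize2^ S
      size = record
        { j       = suc j
        ; enc     = encPair ∘ remQuot (2 ^ j)
        ; enc∈    = λ i → let (c , i′) = remQuot (2 ^ j) i in ∙-closed (proj₁ (enc∈ i′)) (w^∈ c)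
        ; dec     = uncurry combine ∘ decPair
        ; dec∘enc = λ i → trans (cong (uncurry combine) (uncurry decPair∘encPair (remQuot (2 ^ j) i)))
                                (combine-remQuot (2 ^ j) i)
        ; enc∘dec = λ {s} s∈ → begin
            encPair (remQuot (2 ^ j) (combine (χ s) (dec (unshift s))))
              ≡⟨ cong encPair (remQuot-combine (χ s) (dec (unshift s))) ⟩
            enc (dec (unshift s)) ∙ w^ (χ s)
              ≡⟨ cong (_∙ w^ (χ s)) (enc∘dec (unshift∈ s∈)) ⟩
            unshift s ∙ w^ (χ s)
              ≡⟨ //-rightDividesˡ (w^ (χ s)) s ⟩
            s ∎
        }
        where open ≡-Reasoning

    size-from-kernel : HasSize2^ Kernel → HasSize2^ S
    size-from-kernel K with ∃? (λ s → χ s ≡ 1₂) (λ s → χ s Fin.≟ 1₂)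
    ... | yes (w , w∈ , χw) = Doubling.size K w w∈ χw
    ... | no ∄w = record
      { HasSize2^ K
      ; enc∈    = λ i → proj₁ (enc∈ i)
      ; enc∘dec = λ s∈ → enc∘dec (s∈ , χ≡0 s∈) }
      where
        open HasSize2^ K
        χ≡0 : ∀ {s} → S s → χ s ≡ 0₂
        χ≡0 {s} s∈ with 0₂-or-1₂ (χ s)
        ... | inj₁ χs≡0 = χs≡0
        ... | inj₂ χs≡1 = ⊥-elim (∄w (s , s∈ , χs≡1))

module ZBits (q : ℕ) where

  open ZProperties q using (ofℕ-toℕ; ofℕ-cong-%; toℕ-ofℕ)
  open ZProperties 1 using ()
    renaming (ofℕ-cong-% to ofℕ₂-cong-%; ofℕ-+ to ofℕ₂-+; toℕ-ofℕ to toℕ-ofℕ₂)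
  open ℤ₂ using (_+₂_; 0₂)

  private
    instance
      2^q≢0 : NonZero (2 ^ q)
      2^q≢0 = m^n≢0 2 q

  bit : ℕ → Z q → Z 1
  bit b x = ofℕ 1 (_/_ (toℕ x) (2 ^ b) {{m^n≢0 2 b}})

  2^q∣⇒≡0 : ∀ {x} → 2 ^ q ∣ toℕ x → x ≡ zeroZ q
  2^q∣⇒≡0 {x} 2^q∣x = trans (sym (ofℕ-toℕ x))
    (ofℕ-cong-% (trans (n∣m⇒m%n≡0 (toℕ x) (2 ^ q) 2^q∣x) (sym (m*n%n≡0 0 (2 ^ q)))))

  module _ {b : ℕ} where
    private
      instance
        2^b≢0 : NonZero (2 ^ b)
        2^b≢0 = m^n≢0 2 b

    bit≡0⇒2^[1+b]∣ : ∀ {x} → 2 ^ b ∣ toℕ x → bit b x ≡ 0₂ → 2 ^ suc b ∣ toℕ x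
    bit≡0⇒2^[1+b]∣ {x} 2^b∣x bit≡0 = m∣n/o⇒m*o∣n 2^b∣x (m%n≡0⇒n∣m _ 2 x/2^b%2≡0)
      where
        x/2^b%2≡0 : toℕ x / 2 ^ b % 2 ≡ 0
        x/2^b%2≡0 = trans (sym (toℕ-ofℕ₂ (toℕ x / 2 ^ b))) (cong toℕ bit≡0)

    -- Reducing modulo 2^q = 2^(r+1) · 2^b does not change the digit at position b.
    bit-+ : ∀ {r x y} → b + suc r ≡ q → 2 ^ b ∣ toℕ x → 2 ^ b ∣ toℕ y →
            bit b (_+Z_ q x y) ≡ bit b x +₂ bit b y
    bit-+ {r} {x} {y} b+1+r≡q 2^b∣x 2^b∣y = begin
      ofℕ 1 (toℕ (ofℕ q s) / B)
        ≡⟨ cong (λ k → ofℕ 1 (k / B)) (trans (toℕ-ofℕ s) (%-congʳ 2^q≡K*B)) ⟩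
      ofℕ 1 (s % (K * B) / B)
        ≡⟨ cong (ofℕ 1) (m%[n*o]/o≡m/o%n s K B) ⟩
      ofℕ 1 (s / B % K)
        ≡⟨ ofℕ₂-cong-% {s / B % K} {s / B} (m∣n⇒o%n%m≡o%m 2 K (s / B) 2∣K) ⟩
      ofℕ 1 (s / B)
        ≡⟨ cong (ofℕ 1) (+-distrib-/-∣ˡ (toℕ y) 2^b∣x) ⟩
      ofℕ 1 (toℕ x / B + toℕ y / B)
        ≡⟨ ofℕ₂-+ (toℕ x / B) (toℕ y / B) ⟨
      bit b x +₂ bit b y
        ∎
      where
        open ≡-Reasoning
        s = toℕ x + toℕ y
        B = 2 ^ b
        K = 2 ^ suc r
        instance
          K≢0 : NonZero K
          K≢0 = m^n≢0 2 (suc r)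
          K*B≢0 : NonZero (K * B)
          K*B≢0 = m*n≢0 K B
        2∣K : 2 ∣ K
        2∣K = divides (2 ^ r) (*-comm 2 (2 ^ r))
        2^q≡K*B : 2 ^ q ≡ K * B
        2^q≡K*B = trans (cong (2 ^_) (sym b+1+r≡q)) (trans (^-distribˡ-+-* 2 b (suc r)) (*-comm B K))

module SubgroupSize (q : ℕ) where

  open ZProperties q using (negZ; +Z-isAbelianGroup)
  open IsAbelianGroup +Z-isAbelianGroup using (identityˡ)
  open AbelianGroupProperties (≡-abelianGroup +Z-isAbelianGroup) using (ε⁻¹≈ε)
  open ZBits q
  open ℤ₂ using (_+₂_)

  V : ℕ → Set
  V N = Vec (Z q) N

  module Sub {N : ℕ} = Subgroups {V N} (zipWith (_+Z_ q)) (replicate N (zeroZ q)) (map negZ)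
  open Sub using (IsDecSubgroup; HasSize2^)

  V-isAbelianGroup : ∀ N → IsAbelianGroup _≡_ (zipWith (_+Z_ q)) (replicate N (zeroZ q)) (map negZ)
  V-isAbelianGroup = zipWith-isAbelianGroup +Z-isAbelianGroup

  module _ {N : ℕ} {S : V (suc N) → Set} (S-sub : IsDecSubgroup S) where
    open IsDecSubgroup S-sub

    Tail : V N → Set
    Tail s = S (zeroZ q ∷ s)

    tail-isDecSubgroup : IsDecSubgroup Tail
    tail-isDecSubgroup = record
      { ε∈        = ε∈
      ; ∙-closed  = λ {a} {b} a∈ b∈ →
          subst (λ z → S (z ∷ zipWith (_+Z_ q) a b)) (identityˡ (zeroZ q)) (∙-closed a∈ b∈)
      ; ⁻¹-closed = λ {a} a∈ → subst (λ z → S (z ∷ map negZ a)) ε⁻¹≈ε (⁻¹-closed a∈)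
      ; ∃?        = λ Q Q? → map′ (λ { (_ ∷ s , s∈ , refl , Qs) → s , s∈ , Qs })
                                  (λ (s , s∈ , Qs) → zeroZ q ∷ s , s∈ , refl , Qs)
                                  (∃? _ (λ s → (head s Fin.≟ zeroZ q) ×-dec Q? (tail s)))
      }

    size-from-tail : (∀ {s} → S s → head s ≡ zeroZ q) → HasSize2^ Tail → HasSize2^ S
    size-from-tail head≡0 T = record
      { HasSize2^ T
      ; enc     = λ i → zeroZ q ∷ enc i
      ; dec     = λ s → dec (tail s)
      ; enc∘dec = λ { {x ∷ s} s∈ →
          cong₂ _∷_ (sym (head≡0 s∈)) (enc∘dec (subst (λ z → S (z ∷ s)) (head≡0 s∈) s∈)) }
      }
      where open HasSize2^ T

  -- While 2^b divides every first coordinate, bit b of the first coordinate is a homomorphism to ℤ₂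
  -- whose kernel satisfies the hypothesis for b + 1; at b = q the first coordinate vanishes.
  module _ {N : ℕ} (size-V : ∀ {S : V N → Set} → IsDecSubgroup S → HasSize2^ S) where

    size-by-valuation : ∀ r b → b + r ≡ q → ∀ {S : V (suc N) → Set} → IsDecSubgroup S →
                        (∀ {s} → S s → 2 ^ b ∣ toℕ (head s)) → HasSize2^ S
    size-by-valuation zero b b+0≡q S-sub 2^b∣ =
      size-from-tail S-sub (λ s∈ → 2^q∣⇒≡0 (subst (λ c → 2 ^ c ∣ _) b≡q (2^b∣ s∈)))
                     (size-V (tail-isDecSubgroup S-sub))
      where
        b≡q : b ≡ q
        b≡q = trans (sym (+-identityʳ b)) b+0≡q
    size-by-valuation (suc r) b b+1+r≡q {S} S-sub 2^b∣ =
      size-from-kernel S-sub χ χ-∙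
        (size-by-valuation r (suc b) (trans (sym (+-suc b r)) b+1+r≡q)
                           (kernel-isDecSubgroup S-sub χ χ-∙)
          (λ (s∈ , χs≡0) → bit≡0⇒2^[1+b]∣ {b} (2^b∣ s∈) χs≡0))
      where
        open IndexTwo (V-isAbelianGroup (suc N))
        χ : V (suc N) → Z 1
        χ s = bit b (head s)
        χ-∙ : ∀ {s t} → S s → S t → χ (zipWith (_+Z_ q) s t) ≡ χ s +₂ χ t
        χ-∙ {_ ∷ _} {_ ∷ _} s∈ t∈ = bit-+ b+1+r≡q (2^b∣ s∈) (2^b∣ t∈)

  decSubgroup-hasSize2^ : ∀ {N} {S : V N → Set} → IsDecSubgroup S → HasSize2^ S
  decSubgroup-hasSize2^ {zero} S-sub = record
    { j = 0 ; enc = λ _ → [] ; enc∈ = λ _ → ε∈ ; dec = λ _ → Fin.zero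
    ; dec∘enc = λ { Fin.zero → refl } ; enc∘dec = λ { {[]} _ → refl } }
    where open IsDecSubgroup S-sub
  decSubgroup-hasSize2^ {suc N} S-sub = size-by-valuation decSubgroup-hasSize2^ q 0 refl S-sub (λ _ → 1∣ _)

module CFIAutomorphisms (q : ℕ) (G : BaseGraph)
                        (f : Fin (BaseGraph.n G) → Fin (BaseGraph.n G) → Z q) where

  open BaseGraph G
  open CFI q G f
  open ZProperties q using (negZ; +Z-isAbelianGroup; toℕ-zeroZ; ofℕ-+; ofℕ-toℕ)
  open SubgroupSize q using (V; V-isAbelianGroup)

  infixl 6 _⊕_ _⊞_
  infix 7 ⊖_ ⊟_

  _⊕_ : Op₂ (Z q)
  _⊕_ = _+Z_ q
  𝟘 𝟙 : Z q
  𝟘 = zeroZ q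
  𝟙 = oneZ q
  ⊖_ : Op₁ (Z q)
  ⊖_ = negZ

  _⊞_ : ∀ {N} → Op₂ (V N)
  _⊞_ = zipWith _⊕_
  𝟎 : ∀ {N} → V N
  𝟎 = replicate _ 𝟘
  ⊟_ : ∀ {N} → Op₁ (V N)
  ⊟_ = map ⊖_

  module ℤ where
    abelianGroup : AbelianGroup 0ℓ 0ℓ
    abelianGroup = ≡-abelianGroup +Z-isAbelianGroup
    open AbelianGroup abelianGroup public using (identityˡ; identityʳ; inverseˡ; inverseʳ)
    open AbelianGroupProperties abelianGroup public
      using (∙-cancelʳ; ε⁻¹≈ε; ⁻¹-∙-comm; //-rightDividesˡ)
    open CommutativeSemigroupProperties (AbelianGroup.commutativeSemigroup abelianGroup) public
      using (interchange; xy∙z≈xz∙y)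

  module 𝕍 {N : ℕ} where
    abelianGroup : AbelianGroup 0ℓ 0ℓ
    abelianGroup = ≡-abelianGroup (V-isAbelianGroup N)
    open AbelianGroup abelianGroup public using (identityʳ; inverseʳ)
    open AbelianGroupProperties abelianGroup public
      using (∙-cancelˡ; ε⁻¹≈ε; //-rightDividesʳ; //-rightDividesˡ)
    open CommutativeSemigroupProperties (AbelianGroup.commutativeSemigroup abelianGroup) public
      using (interchange; xy∙z≈xz∙y)

  -- Gadgets

  sum-𝟎 : ∀ {N} → sumZ q (𝟎 {N}) ≡ 𝟘
  sum-𝟎 {zero} = refl
  sum-𝟎 {suc N} = trans (cong (𝟘 ⊕_) (sum-𝟎 {N})) (ℤ.identityˡ 𝟘)

  sum-⊞ : ∀ {N} (u v : V N) → sumZ q (u ⊞ v) ≡ sumZ q u ⊕ sumZ q v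
  sum-⊞ [] [] = sym (ℤ.identityˡ 𝟘)
  sum-⊞ (x ∷ u) (y ∷ v) = trans (cong (x ⊕ y ⊕_) (sum-⊞ u v)) (ℤ.interchange x y (sumZ q u) (sumZ q v))

  sum-⊟ : ∀ {N} (u : V N) → sumZ q (⊟ u) ≡ ⊖ sumZ q u
  sum-⊟ [] = sym ℤ.ε⁻¹≈ε
  sum-⊟ (x ∷ u) = trans (cong (⊖ x ⊕_) (sum-⊟ u)) (ℤ.⁻¹-∙-comm x (sumZ q u))

  sum-single : ∀ {N} (z : Fin N) c → sumZ q (𝟎 [ z ]≔ c) ≡ c
  sum-single {suc N} Fin.zero c = trans (cong (c ⊕_) (sum-𝟎 {N})) (ℤ.identityʳ c)
  sum-single (Fin.suc z) c = trans (ℤ.identityˡ _) (sum-single z c)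

  record IsGadget (x : Fin n) (v : V n) : Set where
    field
      off   : ∀ {y} → adj x y ≡ false → lookup v y ≡ 𝟘
      sum≡0 : sumZ q v ≡ 𝟘
  open IsGadget

  T-isZeroZ : ∀ {c} → T (isZeroZ q c) → c ≡ 𝟘
  T-isZeroZ {c} t = toℕ-injective (trans (≡ᵇ⇒≡ (toℕ c) 0 t) (sym toℕ-zeroZ))

  isZeroZ-T : ∀ {c} → c ≡ 𝟘 → T (isZeroZ q c)
  isZeroZ-T {c} c≡0 = ≡⇒≡ᵇ (toℕ c) 0 (trans (cong toℕ c≡0) toℕ-zeroZ)

  gadgetOK⇒IsGadget : ∀ {x v} → T (gadgetOK x v) → IsGadget x v
  gadgetOK⇒IsGadget {x} {v} t = record { off = off′ ; sum≡0 = T-isZeroZ (proj₂ (Equivalence.to T-∧ t)) }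
    where
      off′ : ∀ {y} → adj x y ≡ false → lookup v y ≡ 𝟘
      off′ {y} x≁y with Equivalence.to T-∨
                          (All.lookup (all⁺ _ (allFin n) (proj₁ (Equivalence.to T-∧ t))) (∈-allFin y))
      ... | inj₁ x∼y = ⊥-elim (subst T x≁y x∼y)
      ... | inj₂ vy≡0 = T-isZeroZ vy≡0

  IsGadget⇒gadgetOK : ∀ {x v} → IsGadget x v → T (gadgetOK x v)
  IsGadget⇒gadgetOK {x} {v} v∈ =
    Equivalence.from T-∧ (all⁻ _ {allFin n} (All.tabulate (λ {y} _ → entry y)) , isZeroZ-T (sum≡0 v∈))
    where
      entry : ∀ y → T (adj x y ∨ isZeroZ q (lookup v y))
      entry y with adj x y in x∼y
      ... | true = tt
      ... | false = isZeroZ-T (off v∈ x∼y)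

  gadget : (a : Elem) → IsGadget (vtx a) (vec a)
  gadget a = gadgetOK⇒IsGadget (ok a)

  gadget-𝟎 : ∀ {x} → IsGadget x 𝟎
  gadget-𝟎 = record { off = λ {y} _ → lookup-replicate y 𝟘 ; sum≡0 = sum-𝟎 {n} }

  gadget-⊞ : ∀ {x u v} → IsGadget x u → IsGadget x v → IsGadget x (u ⊞ v)
  gadget-⊞ {u = u} {v} u∈ v∈ = record
    { off   = λ {y} x≁y → trans (lookup-zipWith _⊕_ y u v)
                            (trans (cong₂ _⊕_ (off u∈ x≁y) (off v∈ x≁y)) (ℤ.identityˡ 𝟘))
    ; sum≡0 = trans (sum-⊞ u v) (trans (cong₂ _⊕_ (sum≡0 u∈) (sum≡0 v∈)) (ℤ.identityˡ 𝟘)) }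

  gadget-⊟ : ∀ {x v} → IsGadget x v → IsGadget x (⊟ v)
  gadget-⊟ {v = v} v∈ = record
    { off   = λ {y} x≁y → trans (lookup-map y ⊖_ v) (trans (cong ⊖_ (off v∈ x≁y)) ℤ.ε⁻¹≈ε)
    ; sum≡0 = trans (sum-⊟ v) (trans (cong ⊖_ (sum≡0 v∈)) ℤ.ε⁻¹≈ε) }

  Elem-ext : ∀ {a b} → vtx a ≡ vtx b → vec a ≡ vec b → a ≡ b
  Elem-ext {elem x v a∈} {elem _ _ b∈} refl refl = cong (elem x v) (T-irrelevant a∈ b∈)

  origin : Fin n → Elem
  origin x = elem x 𝟎 (IsGadget⇒gadgetOK gadget-𝟎)

  translate : (g : Fin n → V n) → (∀ x → IsGadget x (g x)) → Elem → Elem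
  translate g g∈ a =
    elem (vtx a) (vec a ⊞ g (vtx a)) (IsGadget⇒gadgetOK (gadget-⊞ (gadget a) (g∈ (vtx a))))

  -- Automorphisms fix the gadgets

  OrderEmbedding : (Elem → Elem) → Set
  OrderEmbedding φ = ∀ a b → RPre a b ⇔ RPre (φ a) (φ b)

  module _ {φ : Elem → Elem} (φ-emb : OrderEmbedding φ) where

    vtx-cong : ∀ {a b} → vtx a ≡ vtx b → vtx (φ a) ≡ vtx (φ b)
    vtx-cong {a} {b} e = Fin.≤-antisym (proj₁ (φ-emb a b) (Fin.≤-reflexive e))
                                       (proj₁ (φ-emb b a) (Fin.≤-reflexive (sym e)))

    vtx≤vtx∘φ : ∀ a → vtx a Fin.≤ vtx (φ a)
    vtx≤vtx∘φ a = subst (vtx a Fin.≤_) (vtx-cong refl) (strictMono⇒inflationary h h-mono (vtx a))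
      where
        h : Fin n → Fin n
        h x = vtx (φ (origin x))
        h-mono : ∀ {x y} → x Fin.< y → h x Fin.< h y
        h-mono {x} {y} x<y =
          ℕ.≰⇒> (λ hy≤hx → ℕ.<⇒≱ x<y (proj₂ (φ-emb (origin y) (origin x)) hy≤hx))

  inv-orderEmbedding : ∀ {m} {p : Vec Elem m} (σ : Aut p) → OrderEmbedding (inv σ)
  inv-orderEmbedding σ a b =
      (λ a≤b → proj₂ (pres-Pre σ (inv σ a) (inv σ b))
                     (subst₂ RPre (sym (inv-r σ a)) (sym (inv-r σ b)) a≤b))
    , (λ ia≤ib → subst₂ RPre (inv-r σ a) (inv-r σ b)
                        (proj₁ (pres-Pre σ (inv σ a) (inv σ b)) ia≤ib))

  -- Both σ and σ⁻¹ can only move gadgets up in the order of V.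
  vtx-fun : ∀ {m} {p : Vec Elem m} (σ : Aut p) a → vtx (fun σ a) ≡ vtx a
  vtx-fun σ a = Fin.≤-antisym
    (subst (vtx (fun σ a) Fin.≤_) (cong vtx (inv-l σ a))
           (vtx≤vtx∘φ {inv σ} (inv-orderEmbedding σ) (fun σ a)))
    (vtx≤vtx∘φ {fun σ} (pres-Pre σ) a)

  -- Automorphisms are translations

  another-neighbour : ∀ x y → (∃ λ y′ → adj x y′ ≡ true × y′ ≢ y)
                            ⊎ (∀ {z} → adj x z ≡ true → z ≡ y)
  another-neighbour x y with Fin.any? (λ z → (adj x z Bool.≟ true) ×-dec ¬? (z Fin.≟ y))
  ... | yes y′ = inj₁ y′
  ... | no ∄y′ = inj₂ sole
    where
      sole : ∀ {z} → adj x z ≡ true → z ≡ y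
      sole {z} x∼z with z Fin.≟ y
      ... | yes z≡y = z≡y
      ... | no z≢y = ⊥-elim (∄y′ (z , x∼z , z≢y))

  private
    true≢false : ∀ {b : Bool} → b ≡ true → b ≡ false → ⊥
    true≢false refl ()

  lookup-single-≢ : ∀ {N} (z : Fin N) c w → w ≢ z → lookup (𝟎 [ z ]≔ c) w ≡ 𝟘
  lookup-single-≢ z c w w≢z = trans (lookup∘update′ w≢z 𝟎 c) (lookup-replicate w 𝟘)

  sole-neighbour⇒at≡0 : ∀ a {y} → (∀ {z} → adj (vtx a) z ≡ true → z ≡ y) → a at y ≡ 𝟘
  sole-neighbour⇒at≡0 a {y} sole = begin
    a at y                   ≡⟨ sum-single y (a at y) ⟨
    sumZ q (𝟎 [ y ]≔ a at y) ≡⟨ cong (sumZ q) vec≡single ⟨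
    sumZ q (vec a)           ≡⟨ sum≡0 (gadget a) ⟩
    𝟘                        ∎
    where
      open ≡-Reasoning
      vec≡single : vec a ≡ 𝟎 [ y ]≔ a at y
      vec≡single = lookup-ext λ z → case? z
        where
          case? : ∀ z → lookup (vec a) z ≡ lookup (𝟎 [ y ]≔ a at y) z
          case? z with z Fin.≟ y | adj (vtx a) z in x∼z
          ... | yes refl | _     = sym (lookup∘update z 𝟎 (a at y))
          ... | no z≢y   | false = trans (off (gadget a) x∼z) (sym (lookup-single-≢ y (a at y) z z≢y))
          ... | no z≢y   | true  = ⊥-elim (z≢y (sole x∼z))

  unitMove : Fin n → Fin n → V n
  unitMove y′ y = (𝟎 [ y′ ]≔ 𝟙) ⊞ (𝟎 [ y ]≔ ⊖ 𝟙)

  unitMove-gadget : ∀ {x y y′} → adj x y ≡ true → adj x y′ ≡ true → IsGadget x (unitMove y′ y)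
  unitMove-gadget {x} {y} {y′} x∼y x∼y′ = record
    { off   = λ {z} x≁z → trans (lookup-zipWith _⊕_ z (𝟎 [ y′ ]≔ 𝟙) (𝟎 [ y ]≔ ⊖ 𝟙))
        (trans (cong₂ _⊕_ (lookup-single-≢ y′ 𝟙 z (λ { refl → true≢false x∼y′ x≁z }))
                          (lookup-single-≢ y (⊖ 𝟙) z (λ { refl → true≢false x∼y x≁z })))
               (ℤ.identityˡ 𝟘))
    ; sum≡0 = trans (sum-⊞ (𝟎 [ y′ ]≔ 𝟙) (𝟎 [ y ]≔ ⊖ 𝟙))
                    (trans (cong₂ _⊕_ (sum-single y′ 𝟙) (sum-single y (⊖ 𝟙))) (ℤ.inverseʳ 𝟙)) }

  unitMove-at : ∀ {y y′} → y′ ≢ y → lookup (unitMove y′ y) y ≡ ⊖ 𝟙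
  unitMove-at {y} {y′} y′≢y = trans (lookup-zipWith _⊕_ y (𝟎 [ y′ ]≔ 𝟙) (𝟎 [ y ]≔ ⊖ 𝟙))
    (trans (cong₂ _⊕_ (lookup-single-≢ y′ 𝟙 y (y′≢y ∘ sym)) (lookup∘update y 𝟎 (⊖ 𝟙)))
           (ℤ.identityˡ (⊖ 𝟙)))

  moveUnit : ∀ a {y y′} → adj (vtx a) y ≡ true → adj (vtx a) y′ ≡ true → Elem
  moveUnit a {y} {y′} x∼y x∼y′ = elem (vtx a) (vec a ⊞ unitMove y′ y)
    (IsGadget⇒gadgetOK (gadget-⊞ (gadget a) (unitMove-gadget x∼y x∼y′)))

  moveUnit-at : ∀ a {y y′} (x∼y : adj (vtx a) y ≡ true) (x∼y′ : adj (vtx a) y′ ≡ true) →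
                y′ ≢ y → moveUnit a x∼y x∼y′ at y ⊕ 𝟙 ≡ a at y
  moveUnit-at a {y} {y′} _ _ y′≢y = begin
    lookup (vec a ⊞ unitMove y′ y) y ⊕ 𝟙
      ≡⟨ cong (_⊕ 𝟙) (lookup-zipWith _⊕_ y (vec a) (unitMove y′ y)) ⟩
    a at y ⊕ lookup (unitMove y′ y) y ⊕ 𝟙
      ≡⟨ cong (λ c → a at y ⊕ c ⊕ 𝟙) (unitMove-at y′≢y) ⟩
    a at y ⊕ ⊖ 𝟙 ⊕ 𝟙
      ≡⟨ ℤ.//-rightDividesˡ 𝟙 (a at y) ⟩
    a at y
      ∎
    where open ≡-Reasoning

  Shift : Set
  Shift = Vec (V n) n

  record _ActsBy_ {m} {p : Vec Elem m} (σ : Aut p) (t : Shift) : Set where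
    constructor actsBy
    field translates : ∀ a → vec (fun σ a) ≡ vec a ⊞ lookup t (vtx a)
  open _ActsBy_

  entry : Shift → Fin n → Fin n → Z q
  entry t x y = lookup (lookup t x) y

  record IsAdmissible {m} (p : Vec Elem m) (t : Shift) : Set where
    field
      gadget-at : ∀ x → IsGadget x (lookup t x)
      balanced  : ∀ x y → adj x y ≡ true → entry t x y ⊕ entry t y x ≡ 𝟘
      fixes-p   : ∀ i → lookup t (vtx (lookup p i)) ≡ 𝟎

  module ShiftOf {m} {p : Vec Elem m} (σ : Aut p) where

    g : Fin n → V n
    g x = vec (fun σ (origin x))

    gadget-fun : ∀ a → IsGadget (vtx a) (vec (fun σ a))
    gadget-fun a = subst (λ z → IsGadget z (vec (fun σ a))) (vtx-fun σ a) (gadget (fun σ a))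

    -- I and C are tested against the gadget of y through the pair (origin y, origin y).
    fun-I : ∀ {a b y} → vtx a ≡ vtx b → adj (vtx a) y ≡ true →
            a at y ≡ b at y → fun σ a at y ≡ fun σ b at y
    fun-I {a} {b} {y} x≡x′ x∼y ay≡by =
      subst (λ z → fun σ a at z ≡ fun σ b at z) (vtx-fun σ (origin y)) (proj₂ (proj₂ (proj₂ (proj₁ (pres-I σ a b (origin y) (origin y)) (x≡x′ , refl , x∼y , ay≡by)))))

    fun-C : ∀ {a b y} → vtx a ≡ vtx b → adj (vtx a) y ≡ true →
            a at y ⊕ 𝟙 ≡ b at y → fun σ a at y ⊕ 𝟙 ≡ fun σ b at y
    fun-C {a} {b} {y} x≡x′ x∼y ay+1≡by =
      subst (λ z → fun σ a at z ⊕ 𝟙 ≡ fun σ b at z) (vtx-fun σ (origin y)) (proj₂ (proj₂ (proj₂ (proj₁ (pres-C σ a b (origin y) (origin y)) (x≡x′ , refl , x∼y , ay+1≡by)))))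

    -- Induction on the value a(y) = k: for k = 0, I compares a with the origin; otherwise C compares a
    -- with the element whose y-coordinate is one less (if y is the only neighbour of x, then a(y) = 0).
    fun-at : ∀ k a {y} → adj (vtx a) y ≡ true → a at y ≡ ofℕ q k →
             fun σ a at y ≡ a at y ⊕ lookup (g (vtx a)) y
    fun-at zero a {y} x∼y ay≡0 = begin
      fun σ a at y                      ≡⟨ fun-I refl x∼y (trans ay≡0 (sym (lookup-replicate y 𝟘))) ⟩
      lookup (g (vtx a)) y              ≡⟨ ℤ.identityˡ _ ⟨
      𝟘 ⊕ lookup (g (vtx a)) y          ≡⟨ cong (_⊕ lookup (g (vtx a)) y) ay≡0 ⟨
      a at y ⊕ lookup (g (vtx a)) y     ∎
      where open ≡-Reasoning
    fun-at (suc k) a {y} x∼y ay≡k+1 with another-neighbour (vtx a) y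
    ... | inj₂ sole = fun-at zero a x∼y (sole-neighbour⇒at≡0 a sole)
    ... | inj₁ (y′ , x∼y′ , y′≢y) = begin
      fun σ a at y                      ≡⟨ fun-C refl x∼y b+1≡a ⟨
      fun σ b at y ⊕ 𝟙                  ≡⟨ cong (_⊕ 𝟙) (fun-at k b x∼y by≡k) ⟩
      b at y ⊕ lookup (g (vtx a)) y ⊕ 𝟙 ≡⟨ ℤ.xy∙z≈xz∙y (b at y) _ 𝟙 ⟩
      b at y ⊕ 𝟙 ⊕ lookup (g (vtx a)) y ≡⟨ cong (_⊕ lookup (g (vtx a)) y) b+1≡a ⟩
      a at y ⊕ lookup (g (vtx a)) y     ∎
      where
        open ≡-Reasoning
        b : Elem
        b = moveUnit a x∼y x∼y′
        b+1≡a : b at y ⊕ 𝟙 ≡ a at y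
        b+1≡a = moveUnit-at a x∼y x∼y′ y′≢y
        [k]+1≡[1+k] : ofℕ q k ⊕ 𝟙 ≡ ofℕ q (suc k)
        [k]+1≡[1+k] = trans (ofℕ-+ k 1) (cong (ofℕ q) (ℕ.+-comm k 1))
        by≡k : b at y ≡ ofℕ q k
        by≡k = ℤ.∙-cancelʳ 𝟙 (b at y) (ofℕ q k) (trans b+1≡a (trans ay≡k+1 (sym [k]+1≡[1+k])))

    vec-fun : ∀ a → vec (fun σ a) ≡ vec a ⊞ g (vtx a)
    vec-fun a = lookup-ext λ y → trans (pointwise y) (sym (lookup-zipWith _⊕_ y (vec a) (g (vtx a))))
      where
        pointwise : ∀ y → fun σ a at y ≡ a at y ⊕ lookup (g (vtx a)) y
        pointwise y with adj (vtx a) y in x∼y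
        ... | true  = fun-at (toℕ (a at y)) a x∼y (sym (ofℕ-toℕ (a at y)))
        ... | false = trans (off (gadget-fun a) x∼y) (sym (trans
          (cong₂ _⊕_ (off (gadget a) x∼y) (off (gadget-fun (origin (vtx a))) x∼y)) (ℤ.identityˡ 𝟘)))

    -- σ maps the pair (origin x, origin y) ∈ E_{xy, 0} = R_{E, -f(xy)} into the same relation.
    g-balanced : ∀ x y → adj x y ≡ true → lookup (g x) y ⊕ lookup (g y) x ≡ 𝟘
    g-balanced x y x∼y = trans σ-edge (ℤ.inverseˡ (f x y))
      where
        origin-edge : REdge (⊖ f x y) (origin x) (origin y)
        origin-edge = x∼y , trans (cong₂ _⊕_ (lookup-replicate y 𝟘) (lookup-replicate x 𝟘))
                                  (trans (ℤ.identityˡ 𝟘) (sym (ℤ.inverseˡ (f x y))))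
        σ-edge : lookup (g x) y ⊕ lookup (g y) x ≡ ⊖ f x y ⊕ f x y
        σ-edge = subst₂ (λ u w → lookup (g x) w ⊕ lookup (g y) u ≡ ⊖ f x y ⊕ f u w)
                        (vtx-fun σ (origin x)) (vtx-fun σ (origin y))
                        (proj₂ (proj₁ (pres-E σ (⊖ f x y) (origin x) (origin y)) origin-edge))

    g-fixes-p : ∀ i → g (vtx (lookup p i)) ≡ 𝟎
    g-fixes-p i = 𝕍.∙-cancelˡ (vec pᵢ) (g (vtx pᵢ)) 𝟎
      (trans (sym (vec-fun pᵢ)) (trans (cong vec (fixes σ i)) (sym (𝕍.identityʳ (vec pᵢ)))))
      where pᵢ = lookup p i

  shiftOf : ∀ {m} {p : Vec Elem m} → Aut p → Shift
  shiftOf σ = tabulate (ShiftOf.g σ)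

  shiftOf-admissible : ∀ {m} {p : Vec Elem m} (σ : Aut p) → IsAdmissible p (shiftOf σ)
  shiftOf-admissible σ = record
    { gadget-at = λ x → subst (IsGadget x) (sym (lookup∘tabulate g x)) (gadget-fun (origin x))
    ; balanced  = λ x y x∼y →
        trans (cong₂ (λ u w → lookup u y ⊕ lookup w x) (lookup∘tabulate g x) (lookup∘tabulate g y))
              (g-balanced x y x∼y)
    ; fixes-p   = λ i → trans (lookup∘tabulate g _) (g-fixes-p i) }
    where open ShiftOf σ

  actsBy-shiftOf : ∀ {m} {p : Vec Elem m} (σ : Aut p) → σ ActsBy shiftOf σ
  actsBy-shiftOf σ = actsBy λ a →
    trans (vec-fun a) (cong (vec a ⊞_) (sym (lookup∘tabulate g (vtx a))))
    where open ShiftOf σ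

  module _ {m} {p : Vec Elem m} {t : Shift} (t-adm : IsAdmissible p t) where

    open IsAdmissible t-adm

    private
      F F⁻ : Elem → Elem
      F  = translate (lookup t) gadget-at
      F⁻ = translate (⊟_ ∘ lookup t) (gadget-⊟ ∘ gadget-at)

      F-at : ∀ a b → vtx a ≡ vtx b → ∀ y → F b at y ≡ b at y ⊕ entry t (vtx a) y
      F-at _ b refl y = lookup-zipWith _⊕_ y (vec b) (lookup t (vtx b))

      F-edge : ∀ {a b} → adj (vtx a) (vtx b) ≡ true →
               F a at vtx b ⊕ F b at vtx a ≡ a at vtx b ⊕ b at vtx a
      F-edge {a} {b} x∼y = begin
        F a at y ⊕ F b at x                             ≡⟨ cong₂ _⊕_ (F-at a a refl y) (F-at b b refl x) ⟩
        a at y ⊕ entry t x y ⊕ (b at x ⊕ entry t y x)   ≡⟨ ℤ.interchange (a at y) _ (b at x) _ ⟩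
        a at y ⊕ b at x ⊕ (entry t x y ⊕ entry t y x)   ≡⟨ cong (a at y ⊕ b at x ⊕_) (balanced x y x∼y) ⟩
        a at y ⊕ b at x ⊕ 𝟘                             ≡⟨ ℤ.identityʳ _ ⟩
        a at y ⊕ b at x                                 ∎
        where
          open ≡-Reasoning
          x = vtx a
          y = vtx b

      F-pres-E : ∀ c a b → REdge c a b ⇔ REdge c (F a) (F b)
      F-pres-E c a b = (λ (x∼y , e) → x∼y , trans (F-edge {a} {b} x∼y) e)
                     , (λ (x∼y , e) → x∼y , trans (sym (F-edge {a} {b} x∼y)) e)

      F-pres-I : ∀ a b c d → RI a b c d ⇔ RI (F a) (F b) (F c) (F d)
      F-pres-I a b c d =
          (λ (x≡x′ , y≡y′ , x∼y , e) → x≡x′ , y≡y′ , x∼y ,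
             trans (F-at a a refl y) (trans (cong (_⊕ k) e) (sym (F-at a b x≡x′ y))))
        , (λ (x≡x′ , y≡y′ , x∼y , e) → x≡x′ , y≡y′ , x∼y ,
             ℤ.∙-cancelʳ k _ _ (trans (sym (F-at a a refl y)) (trans e (F-at a b x≡x′ y))))
        where
          y = vtx c
          k = entry t (vtx a) y

      F-pres-C : ∀ a b c d → RC a b c d ⇔ RC (F a) (F b) (F c) (F d)
      F-pres-C a b c d =
          (λ (x≡x′ , y≡y′ , x∼y , e) → x≡x′ , y≡y′ , x∼y ,
             trans (cong (_⊕ 𝟙) (F-at a a refl y))
               (trans (ℤ.xy∙z≈xz∙y (a at y) k 𝟙) (trans (cong (_⊕ k) e) (sym (F-at a b x≡x′ y)))))
        , (λ (x≡x′ , y≡y′ , x∼y , e) → x≡x′ , y≡y′ , x∼y ,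
             ℤ.∙-cancelʳ k _ _ (trans (sym (ℤ.xy∙z≈xz∙y (a at y) k 𝟙))
               (trans (cong (_⊕ 𝟙) (sym (F-at a a refl y))) (trans e (F-at a b x≡x′ y)))))
        where
          y = vtx c
          k = entry t (vtx a) y

    shiftAut : Aut p
    shiftAut = record
      { fun      = F
      ; inv      = F⁻
      ; inv-l    = λ a → Elem-ext refl (𝕍.//-rightDividesʳ (lookup t (vtx a)) (vec a))
      ; inv-r    = λ a → Elem-ext refl (𝕍.//-rightDividesˡ (lookup t (vtx a)) (vec a))
      ; pres-E   = F-pres-E
      ; pres-Pre = λ _ _ → id , id
      ; pres-I   = F-pres-I
      ; pres-C   = F-pres-C
      ; fixes    = λ i → Elem-ext refl (trans (cong (vec (lookup p i) ⊞_) (fixes-p i)) (𝕍.identityʳ _))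
      }

    shiftAut-actsBy : shiftAut ActsBy t
    shiftAut-actsBy = actsBy λ _ → refl

  actsBy-agree : ∀ {m} {p : Vec Elem m} {σ τ : Aut p} {t t′} → σ ActsBy t → τ ActsBy t′ →
                 ∀ a → (fun σ a ≡ fun τ a) ⇔ (lookup t (vtx a) ≡ lookup t′ (vtx a))
  actsBy-agree {σ = σ} {τ} {t} {t′} σ-t τ-t′ a =
      (λ σa≡τa → 𝕍.∙-cancelˡ (vec a) _ _
                   (trans (sym (translates σ-t a)) (trans (cong vec σa≡τa) (translates τ-t′ a))))
    , (λ tx≡t′x → Elem-ext (trans (vtx-fun σ a) (sym (vtx-fun τ a)))
                   (trans (translates σ-t a) (trans (cong (vec a ⊞_) tx≡t′x) (sym (translates τ-t′ a)))))

  actsBy-comm : ∀ {m} {p : Vec Elem m} {σ τ : Aut p} {t t′} → σ ActsBy t → τ ActsBy t′ →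
                ∀ a → fun σ (fun τ a) ≡ fun τ (fun σ a)
  actsBy-comm {σ = σ} {τ} {t} {t′} σ-t τ-t′ a = Elem-ext
    (trans (vtx-fun σ (fun τ a)) (trans (vtx-fun τ a) (sym (trans (vtx-fun τ (fun σ a)) (vtx-fun σ a)))))
    (begin
      vec (fun σ (fun τ a))
        ≡⟨ translates σ-t (fun τ a) ⟩
      vec (fun τ a) ⊞ lookup t (vtx (fun τ a))
        ≡⟨ cong₂ (λ v z → v ⊞ lookup t z) (translates τ-t′ a) (vtx-fun τ a) ⟩
      vec a ⊞ lookup t′ x ⊞ lookup t x
        ≡⟨ 𝕍.xy∙z≈xz∙y (vec a) (lookup t′ x) (lookup t x) ⟩
      vec a ⊞ lookup t x ⊞ lookup t′ x
        ≡⟨ cong₂ (λ v z → v ⊞ lookup t′ z) (translates σ-t a) (vtx-fun σ a) ⟨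
      vec (fun σ a) ⊞ lookup t′ (vtx (fun σ a))
        ≡⟨ translates τ-t′ (fun σ a) ⟨
      vec (fun τ (fun σ a))
        ∎)
    where
      open ≡-Reasoning
      x = vtx a

  act-comm : ∀ {m} {p : Vec Elem m} {k} (σ τ : Aut p) (v : Vec Elem k) →
             act σ (act τ v) ≡ act τ (act σ v)
  act-comm σ τ v = begin
    map (fun σ) (map (fun τ) v)   ≡⟨ map-∘ (fun σ) (fun τ) v ⟨
    map (fun σ ∘ fun τ) v         ≡⟨ map-cong (actsBy-comm (actsBy-shiftOf σ) (actsBy-shiftOf τ)) v ⟩
    map (fun τ ∘ fun σ) v         ≡⟨ map-∘ (fun τ) (fun σ) v ⟩
    map (fun τ) (map (fun σ) v)   ∎
    where open ≡-Reasoning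

  -- The induced group on an orbit

  infixl 6 _⊞ₛ_

  _⊞ₛ_ : Op₂ Shift
  _⊞ₛ_ = zipWith _⊞_
  𝟎ₛ : Shift
  𝟎ₛ = replicate n 𝟎
  ⊟ₛ : Op₁ Shift
  ⊟ₛ = map ⊟_

  module _ {m} {p : Vec Elem m} where

    open IsAdmissible

    admissible-𝟎 : IsAdmissible p 𝟎ₛ
    admissible-𝟎 = record
      { gadget-at = λ x → subst (IsGadget x) (sym (lookup-replicate x 𝟎)) gadget-𝟎
      ; balanced  = λ x y _ → trans (cong₂ _⊕_ (entry-𝟎ₛ x y) (entry-𝟎ₛ y x)) (ℤ.identityˡ 𝟘)
      ; fixes-p   = λ i → lookup-replicate (vtx (lookup p i)) 𝟎 }
      where
        entry-𝟎ₛ : ∀ x y → entry 𝟎ₛ x y ≡ 𝟘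
        entry-𝟎ₛ x y = trans (cong (λ v → lookup v y) (lookup-replicate x 𝟎)) (lookup-replicate y 𝟘)

    admissible-⊞ : ∀ {t t′} → IsAdmissible p t → IsAdmissible p t′ → IsAdmissible p (t ⊞ₛ t′)
    admissible-⊞ {t} {t′} t-adm t′-adm = record
      { gadget-at = λ x → subst (IsGadget x) (sym (lookup-⊞ₛ x))
                                (gadget-⊞ (gadget-at t-adm x) (gadget-at t′-adm x))
      ; balanced  = balanced-⊞
      ; fixes-p   = λ i → trans (lookup-⊞ₛ _)
                                (trans (cong₂ _⊞_ (fixes-p t-adm i) (fixes-p t′-adm i)) (𝕍.identityʳ 𝟎)) }
      where
        lookup-⊞ₛ : ∀ x → lookup (t ⊞ₛ t′) x ≡ lookup t x ⊞ lookup t′ x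
        lookup-⊞ₛ x = lookup-zipWith _⊞_ x t t′
        entry-⊞ₛ : ∀ x y → entry (t ⊞ₛ t′) x y ≡ entry t x y ⊕ entry t′ x y
        entry-⊞ₛ x y = trans (cong (λ v → lookup v y) (lookup-⊞ₛ x))
                             (lookup-zipWith _⊕_ y (lookup t x) (lookup t′ x))
        balanced-⊞ : ∀ x y → adj x y ≡ true → entry (t ⊞ₛ t′) x y ⊕ entry (t ⊞ₛ t′) y x ≡ 𝟘
        balanced-⊞ x y x∼y = begin
          entry (t ⊞ₛ t′) x y ⊕ entry (t ⊞ₛ t′) y x
            ≡⟨ cong₂ _⊕_ (entry-⊞ₛ x y) (entry-⊞ₛ y x) ⟩
          (entry t x y ⊕ entry t′ x y) ⊕ (entry t y x ⊕ entry t′ y x)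
            ≡⟨ ℤ.interchange (entry t x y) _ _ _ ⟩
          (entry t x y ⊕ entry t y x) ⊕ (entry t′ x y ⊕ entry t′ y x)
            ≡⟨ cong₂ _⊕_ (balanced t-adm x y x∼y) (balanced t′-adm x y x∼y) ⟩
          𝟘 ⊕ 𝟘
            ≡⟨ ℤ.identityˡ 𝟘 ⟩
          𝟘 ∎
          where open ≡-Reasoning

    admissible-⊟ : ∀ {t} → IsAdmissible p t → IsAdmissible p (⊟ₛ t)
    admissible-⊟ {t} t-adm = record
      { gadget-at = λ x → subst (IsGadget x) (sym (lookup-⊟ₛ x)) (gadget-⊟ (gadget-at t-adm x))
      ; balanced  = λ x y x∼y → begin
          entry (⊟ₛ t) x y ⊕ entry (⊟ₛ t) y x    ≡⟨ cong₂ _⊕_ (entry-⊟ₛ x y) (entry-⊟ₛ y x) ⟩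
          ⊖ entry t x y ⊕ ⊖ entry t y x          ≡⟨ ℤ.⁻¹-∙-comm (entry t x y) (entry t y x) ⟩
          ⊖ (entry t x y ⊕ entry t y x)          ≡⟨ cong ⊖_ (balanced t-adm x y x∼y) ⟩
          ⊖ 𝟘                                    ≡⟨ ℤ.ε⁻¹≈ε ⟩
          𝟘                                      ∎
      ; fixes-p   = λ i → trans (lookup-⊟ₛ _) (trans (cong ⊟_ (fixes-p t-adm i)) 𝕍.ε⁻¹≈ε) }
      where
        open ≡-Reasoning
        lookup-⊟ₛ : ∀ x → lookup (⊟ₛ t) x ≡ ⊟ lookup t x
        lookup-⊟ₛ x = lookup-map x ⊟_ t
        entry-⊟ₛ : ∀ x y → entry (⊟ₛ t) x y ≡ ⊖ entry t x y
        entry-⊟ₛ x y = trans (cong (λ v → lookup v y) (lookup-⊟ₛ x)) (lookup-map y ⊖_ (lookup t x))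

  isGadget? : ∀ x v → Dec (IsGadget x v)
  isGadget? x v = map′ gadgetOK⇒IsGadget IsGadget⇒gadgetOK (T? (gadgetOK x v))

  isAdmissible? : ∀ {m} (p : Vec Elem m) t → Dec (IsAdmissible p t)
  isAdmissible? p t = map′ (λ (g , b , fx) → record { gadget-at = g ; balanced = b ; fixes-p = fx })
                           (λ t-adm → gadget-at t-adm , balanced t-adm , fixes-p t-adm)
    (Fin.all? (λ x → isGadget? x (lookup t x))
     ×-dec Fin.all? (λ x → Fin.all? λ y → (adj x y Bool.≟ true) →-dec balanced? x y)
     ×-dec Fin.all? (λ i → ≡-dec Fin._≟_ (lookup t (vtx (lookup p i))) 𝟎))
    where
      open IsAdmissible
      balanced? : ∀ x y → Dec (entry t x y ⊕ entry t y x ≡ 𝟘)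
      balanced? x y = entry t x y ⊕ entry t y x Fin.≟ 𝟘

  ∃-Shift? : ∀ {P : Shift → Set} → Decidable P → Dec (∃ P)
  ∃-Shift? = ∃-Vec? (∃-Vec? Fin.any? n) n

  shiftOn : ∀ {k} → Shift → Vec Elem k → V (k * n)
  shiftOn t [] = []
  shiftOn t (a ∷ u) = lookup t (vtx a) ++ shiftOn t u

  module _ {m} {p : Vec Elem m} {σ τ : Aut p} {t t′} (σ-t : σ ActsBy t) (τ-t′ : τ ActsBy t′) where

    act≡⇒shiftOn≡ : ∀ {k} (u : Vec Elem k) → act σ u ≡ act τ u → shiftOn t u ≡ shiftOn t′ u
    act≡⇒shiftOn≡ [] _ = refl
    act≡⇒shiftOn≡ (a ∷ u) e =
      cong₂ _++_ (proj₁ (actsBy-agree σ-t τ-t′ a) (∷-injectiveˡ e)) (act≡⇒shiftOn≡ u (∷-injectiveʳ e))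

    shiftOn≡⇒act≡ : ∀ {k} (u : Vec Elem k) → shiftOn t u ≡ shiftOn t′ u → act σ u ≡ act τ u
    shiftOn≡⇒act≡ [] _ = refl
    shiftOn≡⇒act≡ (a ∷ u) e with ++-injective (lookup t (vtx a)) (lookup t′ (vtx a)) e
    ... | head≡ , tail≡ = cong₂ _∷_ (proj₂ (actsBy-agree σ-t τ-t′ a) head≡) (shiftOn≡⇒act≡ u tail≡)

  shiftOn-𝟎 : ∀ {k} (u : Vec Elem k) → shiftOn 𝟎ₛ u ≡ 𝟎
  shiftOn-𝟎 [] = refl
  shiftOn-𝟎 {suc k} (a ∷ u) =
    trans (cong₂ _++_ (lookup-replicate (vtx a) 𝟎) (shiftOn-𝟎 u)) (replicate-++ n (k * n) 𝟘)

  shiftOn-⊞ : ∀ t t′ {k} (u : Vec Elem k) → shiftOn (t ⊞ₛ t′) u ≡ shiftOn t u ⊞ shiftOn t′ u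
  shiftOn-⊞ t t′ [] = refl
  shiftOn-⊞ t t′ (a ∷ u) = trans (cong₂ _++_ (lookup-zipWith _⊞_ (vtx a) t t′) (shiftOn-⊞ t t′ u))
    (sym (zipWith-++ _⊕_ (lookup t (vtx a)) (shiftOn t u) (lookup t′ (vtx a)) (shiftOn t′ u)))

  shiftOn-⊟ : ∀ t {k} (u : Vec Elem k) → shiftOn (⊟ₛ t) u ≡ ⊟ shiftOn t u
  shiftOn-⊟ t [] = refl
  shiftOn-⊟ t (a ∷ u) = trans (cong₂ _++_ (lookup-map (vtx a) ⊟_ t) (shiftOn-⊟ t u))
                              (sym (map-++ ⊖_ (lookup t (vtx a)) (shiftOn t u)))

  module _ {m k} (p : Vec Elem m) (u : Vec Elem k) where

    open SubgroupSize q using (decSubgroup-hasSize2^; module Sub)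
    open Sub using (IsDecSubgroup; HasSize2^)

    idAut : Aut p
    idAut = record
      { fun = id ; inv = id ; inv-l = λ _ → refl ; inv-r = λ _ → refl
      ; pres-E = λ _ _ _ → id , id ; pres-Pre = λ _ _ → id , id
      ; pres-I = λ _ _ _ _ → id , id ; pres-C = λ _ _ _ _ → id , id
      ; fixes = λ _ → refl }

    u∈orbit : InOrbit p u u
    u∈orbit = idAut , map-id u

    -- In an abelian group, an automorphism is determined on the whole orbit by its value at u.
    agree-on-orbit : ∀ σ τ → act σ u ≡ act τ u → ∀ v → InOrbit p u v → act σ v ≡ act τ v
    agree-on-orbit σ τ σu≡τu _ (ρ , refl) =
      trans (act-comm σ ρ u) (trans (cong (act ρ) σu≡τu) (sym (act-comm τ ρ u)))

    induced-abelian : InducedAbelian p u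
    induced-abelian σ τ v _ = act-comm σ τ v

    -- σ u is carried to τ u by the translation with shift(τ) − shift(σ).
    induced-transitive : InducedTransitive p u
    induced-transitive _ _ (σ , refl) (τ , refl) = ρ , (begin
      map (fun ρ) (map (fun σ) u)   ≡⟨ map-∘ (fun ρ) (fun σ) u ⟨
      map (fun ρ ∘ fun σ) u         ≡⟨ map-cong ρσ≡τ u ⟩
      map (fun τ) u                 ∎)
      where
        open ≡-Reasoning
        tσ = shiftOf σ
        tτ = shiftOf τ
        ρ : Aut p
        ρ = shiftAut (admissible-⊞ (shiftOf-admissible τ) (admissible-⊟ (shiftOf-admissible σ)))
        lookup-τ-σ : ∀ x → lookup (tτ ⊞ₛ ⊟ₛ tσ) x ≡ lookup tτ x ⊞ ⊟ lookup tσ x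
        lookup-τ-σ x =
          trans (lookup-zipWith _⊞_ x tτ (⊟ₛ tσ)) (cong (lookup tτ x ⊞_) (lookup-map x ⊟_ tσ))
        ρσ≡τ : ∀ a → fun ρ (fun σ a) ≡ fun τ a
        ρσ≡τ a = Elem-ext (trans (vtx-fun σ a) (sym (vtx-fun τ a))) (begin
          vec (fun σ a) ⊞ lookup (tτ ⊞ₛ ⊟ₛ tσ) (vtx (fun σ a))
            ≡⟨ cong₂ (λ v z → v ⊞ lookup (tτ ⊞ₛ ⊟ₛ tσ) z)
                     (translates (actsBy-shiftOf σ) a) (vtx-fun σ a) ⟩
          vec a ⊞ lookup tσ x ⊞ lookup (tτ ⊞ₛ ⊟ₛ tσ) x
            ≡⟨ cong (vec a ⊞ lookup tσ x ⊞_) (lookup-τ-σ x) ⟩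
          vec a ⊞ lookup tσ x ⊞ (lookup tτ x ⊞ ⊟ lookup tσ x)
            ≡⟨ 𝕍.interchange (vec a) (lookup tσ x) (lookup tτ x) _ ⟩
          vec a ⊞ lookup tτ x ⊞ (lookup tσ x ⊞ ⊟ lookup tσ x)
            ≡⟨ cong (vec a ⊞ lookup tτ x ⊞_) (𝕍.inverseʳ (lookup tσ x)) ⟩
          vec a ⊞ lookup tτ x ⊞ 𝟎
            ≡⟨ 𝕍.identityʳ _ ⟩
          vec a ⊞ lookup tτ x
            ≡⟨ translates (actsBy-shiftOf τ) a ⟨
          vec (fun τ a) ∎)
          where x = vtx a

    induced-hasOrbitSize : InducedHasOrbitSize p u
    induced-hasOrbitSize = record
      { to        = λ σ → act σ u , σ , refl
      ; from      = λ (_ , σ , _) → σ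
      ; to-cong   = λ σ≈τ → σ≈τ u u∈orbit
      ; from-cong = λ { {_ , σ , σu≡v} {_ , τ , τu≡w} v≡w →
                          agree-on-orbit σ τ (trans σu≡v (trans v≡w (sym τu≡w))) }
      ; inverse   = (λ { {_ , σ , σu≡v} {τ} τ≈σ → trans (τ≈σ u u∈orbit) σu≡v })
                  , (λ { {τ} {_ , σ , σu≡v} σu≡τu → agree-on-orbit σ τ (trans σu≡v σu≡τu) })
      }

    Image : V (k * n) → Set
    Image s = ∃ λ t → IsAdmissible p t × shiftOn t u ≡ s

    image-isDecSubgroup : IsDecSubgroup Image
    image-isDecSubgroup = record
      { ε∈        = 𝟎ₛ , admissible-𝟎 , shiftOn-𝟎 u
      ; ∙-closed  = λ { (t , t-adm , refl) (t′ , t′-adm , refl) →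
                          t ⊞ₛ t′ , admissible-⊞ t-adm t′-adm , shiftOn-⊞ t t′ u }
      ; ⁻¹-closed = λ { (t , t-adm , refl) → ⊟ₛ t , admissible-⊟ t-adm , shiftOn-⊟ t u }
      ; ∃?        = λ Q Q? → map′ (λ (t , t-adm , Qt) → shiftOn t u , (t , t-adm , refl) , Qt)
                                  (λ { (_ , (t , t-adm , refl) , Qs) → t , t-adm , Qs })
                                  (∃-Shift? (λ t → isAdmissible? p t ×-dec Q? (shiftOn t u)))
      }

    -- σ is coded by the shifts it applies to the gadgets of u, which by agree-on-orbit
    -- identifies exactly the automorphisms inducing the same permutation of the orbit.
    induced-2group : Induced2Group p u
    induced-2group = j , record
      { to        = λ σ → dec (code σ)
      ; from      = ρ
      ; to-cong   = λ {σ} {τ} σ≈τ →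
          cong dec (act≡⇒shiftOn≡ (actsBy-shiftOf σ) (actsBy-shiftOf τ) u (σ≈τ u u∈orbit))
      ; from-cong = λ { refl _ _ → refl }
      ; inverse   = (λ {i} {σ} σ≈ρᵢ → trans (cong dec (trans
                       (act≡⇒shiftOn≡ (actsBy-shiftOf σ) (ρ-actsBy i) u (σ≈ρᵢ u u∈orbit))
                       (code-ρ i))) (dec∘enc i))
                  , (λ {σ} {i} i≡σ → agree-on-orbit (ρ i) σ
                       (shiftOn≡⇒act≡ (ρ-actsBy i) (actsBy-shiftOf σ) u
                         (trans (code-ρ i) (trans (cong enc i≡σ) (enc∘dec (code∈Image σ))))))
      }
      where
        open HasSize2^ (decSubgroup-hasSize2^ image-isDecSubgroup)
        code : Aut p → V (k * n)
        code σ = shiftOn (shiftOf σ) u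
        code∈Image : ∀ σ → Image (code σ)
        code∈Image σ = shiftOf σ , shiftOf-admissible σ , refl
        ρ : Fin (2 ^ j) → Aut p
        ρ i = shiftAut (proj₁ (proj₂ (enc∈ i)))
        ρ-actsBy : ∀ i → ρ i ActsBy proj₁ (enc∈ i)
        ρ-actsBy i = shiftAut-actsBy (proj₁ (proj₂ (enc∈ i)))
        code-ρ : ∀ i → shiftOn (proj₁ (enc∈ i)) u ≡ enc i
        code-ρ i = proj₂ (proj₂ (enc∈ i))

mainTheorem17 : (k m d q : ℕ) (G : BaseGraph)
    → IsConnectedN G (k + m + 1)
    → IsRegular G d
    → (f : Fin (BaseGraph.n G) → Fin (BaseGraph.n G) → Z q)
    → (∀ x y → f x y ≡ f y x)
    → (p : Vec (CFI.Elem q G f) m)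
    → (u : Vec (CFI.Elem q G f) k)
    → CFI.InducedRegular q G f p u
    × CFI.InducedAbelian q G f p u
    × CFI.Induced2Group q G f p u
mainTheorem17 k m d q G _ _ f _ p u =
  (induced-transitive p u , induced-hasOrbitSize p u) , induced-abelian p u , induced-2group p u
  where open CFIAutomorphisms q G f
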